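{- Run algorithm $\mathrm{Square}$ (defined in the context) on requests $r_1,\dots,r_N$. Let $\ell<j$ be indices with $v_j-\rho(j)<u_\ell\le v_j$. Then $t_j-\rho(j)\ge t_\ell+4\rho(\ell)$.
   Context: Time-line graph: nodes $0,1,\dots,n$ of a directed line; replicas $(v,t)$, $t\in\{0,1,2,\dots\}$; horizontal edges $((u,t),(u+1,t))$ and arcs $((v,t),(v,t+1))$. Requests $r_i=(v_i,t_i)$, $i=1,\dots,N$, with $0\le t_1\le\dots\le t_N$ and integer coordinates. $d_\infty((u,s),(v,t))=\max\{t-s,v-u\}$ if $s\le t,u\le v$, else $\infty$. Algorithm $\mathrm{Square}$: start with $F=\{(0,0)\}$, $t_0=0$. For $i=1,\dots,N$: (SQ1) add arcs from $(0,t_{i-1})$ to $(0,t_i)$; (SQ2) $\rho(i)=\min\{d_\infty(q,r_i): q\text{ a replica of }F\}$; (SQ3) among replicas of $F$ in $[v_i-5\rho(i),v_i]\times[t_i-5\rho(i),t_i]$ choose $q_i=(u_i,s_i)$ with $u_i$ minimal (ties arbitrary); (SQ4) add arcs from $(u_i,s_i)$ to $(u_i,t_i)$ and horizontal edges from $(u_i,t_i)$ to $(v_i,t_i)$; (SQ5) add arcs from $(u_i,t_i)$ to $(u_i,t_i+4\rho(i))$. -}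

module Defs where

open import Data.Nat using (ℕ; zero; suc; _+_; _*_; _∸_; _⊔_; _≤_; _<_)
open import Data.Product using (Σ; _×_; ∃; ∃-syntax; _,_)
open import Data.Sum using (_⊎_)
open import Relation.Binary.PropositionalEquality using (_≡_)

-- Requests r_i = (v i , t i) for i = 1..N (values at other indices are ignored).
-- t_0 := 0 : the "previous request time" used in step i (i ≥ 1).
tPrev : (ℕ → ℕ) → ℕ → ℕ
tPrev t zero = 0
tPrev t (suc zero) = 0
tPrev t (suc (suc i)) = t (suc i)

-- Infinity-distance from replica (x , y) to request (v , t) is finite iff
-- x ≤ v and y ≤ t, and then equals max(t - y, v - x).
dInf : ℕ → ℕ → ℕ → ℕ → ℕ
dInf x y v t = (t ∸ y) ⊔ (v ∸ x)

module SquareAlg (v t ρ u s : ℕ → ℕ) where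

  SQ1 : ℕ → ℕ → ℕ → Set
  SQ1 i x y = x ≡ 0 × tPrev t i ≤ y × y ≤ t i

  SQ4arc : ℕ → ℕ → ℕ → Set
  SQ4arc i x y = x ≡ u i × s i ≤ y × y ≤ t i

  SQ4hor : ℕ → ℕ → ℕ → Set
  SQ4hor i x y = y ≡ t i × u i ≤ x × x ≤ v i

  SQ5 : ℕ → ℕ → ℕ → Set
  SQ5 i x y = x ≡ u i × t i ≤ y × y ≤ t i + 4 * ρ i

  Added : ℕ → ℕ → ℕ → Set
  Added i x y = SQ1 i x y ⊎ SQ4arc i x y ⊎ SQ4hor i x y ⊎ SQ5 i x y

  Rep : ℕ → ℕ → ℕ → Set
  Rep k x y = (x ≡ 0 × y ≡ 0) ⊎ (∃[ i ] (1 ≤ i × i ≤ k × Added i x y))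

  -- replicas of F in step i just after (SQ1), i.e. at the time of (SQ2)/(SQ3)
  FAt : ℕ → ℕ → ℕ → Set
  FAt i x y = Rep (i ∸ 1) x y ⊎ SQ1 i x y

  InBox : ℕ → ℕ → ℕ → Set
  InBox i x y = v i ≤ x + 5 * ρ i × x ≤ v i × t i ≤ y + 5 * ρ i × y ≤ t i

  -- step i of Square made the choices ρ(i), q_i = (u i , s i)
  record ValidStep (i : ℕ) : Set where
    field
      ρ-attained : ∃[ x ] ∃[ y ] (FAt i x y × x ≤ v i × y ≤ t i × ρ i ≡ dInf x y (v i) (t i))
      ρ-minimal  : ∀ x y → FAt i x y → x ≤ v i → y ≤ t i → ρ i ≤ dInf x y (v i) (t i)
      q-in-F     : FAt i (u i) (s i)
      q-in-box   : InBox i (u i) (s i)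
      q-minimal  : ∀ x y → FAt i x y → InBox i x y → u i ≤ x

SquareRun : ℕ → (v t ρ u s : ℕ → ℕ) → Set
SquareRun N v t ρ u s = ∀ i → 1 ≤ i → i ≤ N → SquareAlg.ValidStep v t ρ u s i

-- The replicas (u_ℓ, y), t_ℓ ≤ y ≤ t_ℓ + 4ρ(ℓ), added by (SQ5) in step ℓ are
-- still in F at step j. Their node u_ℓ is within ρ(j) of v_j, so the minimality
-- of ρ(j) in (SQ2) forces each of them that lies below r_j to be at least ρ(j)
-- earlier in time than t_j. The top one, at time t_ℓ + 4ρ(ℓ), lies below r_j:
-- otherwise the one at time t_j ≥ t_ℓ would itself be at distance < ρ(j).
module Submission where

open import Defs
open import Data.Nat using (ℕ; suc; _+_; _*_; _∸_; _⊔_; _≤_; _<_; z≤n; _≤′_; ≤′-refl; ≤′-step; _≤?_)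
open import Data.Nat.Properties
open import Data.Product using (_,_)
open import Data.Sum using (inj₁; inj₂)
open import Relation.Nullary using (yes; no; contradiction)
open import Relation.Binary.PropositionalEquality using (refl; sym; subst)

≤⊔∧<ʳ⇒≤ˡ : ∀ {m n o} → m ≤ n ⊔ o → o < m → m ≤ n
≤⊔∧<ʳ⇒≤ˡ {m} {n} {o} m≤n⊔o o<m with ⊔-sel n o
... | inj₁ n⊔o≡n = subst (m ≤_) n⊔o≡n m≤n⊔o
... | inj₂ n⊔o≡o = contradiction (subst (m ≤_) n⊔o≡o m≤n⊔o) (<⇒≱ o<m)

n<m+o⇒n∸m<o : ∀ {m n o} → m ≤ n → n < m + o → n ∸ m < o
n<m+o⇒n∸m<o {m} {n} {o} m≤n n<m+o =
  +-cancelˡ-< m (n ∸ m) o (subst (_< m + o) (sym (m+[n∸m]≡n m≤n)) n<m+o)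

ascending⇒monotone : ∀ {N} (t : ℕ → ℕ) → (∀ i → 1 ≤ i → i < N → t i ≤ t (suc i))
                   → ∀ {ℓ j} → 1 ≤ ℓ → ℓ ≤ j → j ≤ N → t ℓ ≤ t j
ascending⇒monotone {N} t ascending {ℓ} 1≤ℓ ℓ≤j = go (≤⇒≤′ ℓ≤j)
  where
    go : ∀ {j} → ℓ ≤′ j → j ≤ N → t ℓ ≤ t j
    go ≤′-refl _ = ≤-refl
    go (≤′-step {j} ℓ≤′j) 1+j≤N =
      ≤-trans (go ℓ≤′j (<⇒≤ 1+j≤N)) (ascending j (≤-trans 1≤ℓ (≤′⇒≤ ℓ≤′j)) 1+j≤N)

module SquareProperties (v t ρ u s : ℕ → ℕ) where
  open SquareAlg v t ρ u s

  SQ5⇒FAt : ∀ {ℓ j y} → 1 ≤ ℓ → ℓ < j → t ℓ ≤ y → y ≤ t ℓ + 4 * ρ ℓ → FAt j (u ℓ) y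
  SQ5⇒FAt {ℓ} 1≤ℓ ℓ<j tℓ≤y y≤top =
    inj₁ (inj₂ (ℓ , 1≤ℓ , ∸-monoˡ-≤ 1 ℓ<j , inj₂ (inj₂ (inj₂ (refl , tℓ≤y , y≤top)))))

  near-column⇒ρ-earlier : ∀ {j x y} → ValidStep j → FAt j x y → x ≤ v j → y ≤ t j
                        → v j < x + ρ j → y + ρ j ≤ t j
  near-column⇒ρ-earlier {j} {x} {y} step inF x≤vj y≤tj vj<x+ρj =
    subst (y + ρ j ≤_) (m+[n∸m]≡n y≤tj) (+-monoʳ-≤ y ρj≤tj∸y)
    where
      open ValidStep step
      ρj≤tj∸y : ρ j ≤ t j ∸ y
      ρj≤tj∸y = ≤⊔∧<ʳ⇒≤ˡ (ρ-minimal x y inF x≤vj y≤tj) (n<m+o⇒n∸m<o x≤vj vj<x+ρj)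

  SQ5-top⇒ρ-earlier : ∀ {ℓ j} → ValidStep j → 1 ≤ ℓ → ℓ < j → t ℓ ≤ t j
                    → u ℓ ≤ v j → v j < u ℓ + ρ j → t ℓ + 4 * ρ ℓ + ρ j ≤ t j
  SQ5-top⇒ρ-earlier {ℓ} {j} step 1≤ℓ ℓ<j tℓ≤tj uℓ≤vj vj<uℓ+ρj with t ℓ + 4 * ρ ℓ ≤? t j
  ... | yes top≤tj =
    near-column⇒ρ-earlier step (SQ5⇒FAt 1≤ℓ ℓ<j (m≤m+n (t ℓ) _) ≤-refl) uℓ≤vj top≤tj vj<uℓ+ρj
  ... | no top≰tj = contradiction tj+ρj≤tj (<⇒≱ (m<m+n (t j) ρj>0))
    where
      tj+ρj≤tj : t j + ρ j ≤ t j
      tj+ρj≤tj = near-column⇒ρ-earlier step (SQ5⇒FAt 1≤ℓ ℓ<j tℓ≤tj (<⇒≤ (≰⇒> top≰tj)))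
                   uℓ≤vj ≤-refl vj<uℓ+ρj
      ρj>0 : 0 < ρ j
      ρj>0 = ≤-<-trans z≤n (n<m+o⇒n∸m<o uℓ≤vj vj<uℓ+ρj)

lemma3 : (n N : ℕ) (v t : ℕ → ℕ)
         → (∀ i → 1 ≤ i → i ≤ N → v i ≤ n)
         → (∀ i → 1 ≤ i → i < N → t i ≤ t (suc i))
         → (ρ u s : ℕ → ℕ) → SquareRun N v t ρ u s
         → ∀ ℓ j → 1 ≤ ℓ → ℓ < j → j ≤ N
         → v j < u ℓ + ρ j → u ℓ ≤ v j
         → t ℓ + 4 * ρ ℓ + ρ j ≤ t j
lemma3 _ N v t _ ascending ρ u s run ℓ j 1≤ℓ ℓ<j j≤N vj<uℓ+ρj uℓ≤vj =
  SquareProperties.SQ5-top⇒ρ-earlier v t ρ u s (run j 1≤j j≤N) 1≤ℓ ℓ<j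
    (ascending⇒monotone t ascending 1≤ℓ (<⇒≤ ℓ<j) j≤N) uℓ≤vj vj<uℓ+ρj
  where
    1≤j : 1 ≤ j
    1≤j = ≤-trans 1≤ℓ (<⇒≤ ℓ<j)
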